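{- For every positive integer $m$, \[\sum_{k=1}^m 2k\binom{2m}{m-k}\binom{2m}{m+k} = 2m\binom{2m-1}{m-1}^2.\] -}

module Defs where

open import Data.Nat using (ℕ; zero; suc; _+_)

sumFrom1 : ℕ → (ℕ → ℕ) → ℕ
sumFrom1 zero    f = 0
sumFrom1 (suc m) f = sumFrom1 m f + f (suc m)

{-# OPTIONS --safe #-}
module Submission where

-- By symmetry the summand is 2i C(2m,m+i)². Writing N = 2m − 1, the tail of the sum over
-- i > k has the closed form 2m C(N,m+k)², so the sum telescopes from 2m C(N,m)² = 2m C(N,m−1)²
-- down to 2m C(N,2m)² = 0. For one step put v = C(N,m+k), u = C(N,m+k+1): Pascal's rule gives
-- C(2m,m+k+1) = v + u and absorption gives (m+k+1) u = (m−k−1) v, whence 2(k+1)(v+u)² = 2m (v² − u²).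

open import Defs
open import Data.Nat using (ℕ; zero; suc; _+_; _*_; _∸_; _^_; _<_; s≤s)
open import Data.Nat.Properties
open import Data.Nat.Combinatorics
  using (_C_; nC1≡n; k>n⇒nCk≡0; nCk≡nC[n∸k]; nCk+nC[k+1]≡[n+1]C[k+1])
open import Data.Nat.Tactic.RingSolver using (solve-∀)
open import Algebra.Definitions.RawMagma using (_,_)
open import Function using (_∘_)
open import Relation.Binary.PropositionalEquality
open ≡-Reasoning

sumFrom1-telescope : ∀ m (f g : ℕ → ℕ) → (∀ {k} → k < m → f (suc k) + g (suc k) ≡ g k) →
                     sumFrom1 m f + g m ≡ g 0
sumFrom1-telescope zero    f g step = refl
sumFrom1-telescope (suc m) f g step = begin
  sumFrom1 m f + f (suc m) + g (suc m)    ≡⟨ +-assoc (sumFrom1 m f) _ _ ⟩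
  sumFrom1 m f + (f (suc m) + g (suc m))  ≡⟨ cong (sumFrom1 m f +_) (step (n<1+n m)) ⟩
  sumFrom1 m f + g m                      ≡⟨ sumFrom1-telescope m f g (step ∘ m<n⇒m<1+n) ⟩
  g 0                                     ∎

[m+n]Cm≡[m+n]Cn : ∀ m n → (m + n) C m ≡ (m + n) C n
[m+n]Cm≡[m+n]Cn m n = trans (nCk≡nC[n∸k] (m≤m+n m n)) (cong ((m + n) C_) (m+n∸m≡n m n))

[k+1]*nC[k+1]+k*nCk≡n*nCk : ∀ n k → suc k * (n C suc k) + k * (n C k) ≡ n * (n C k)
[k+1]*nC[k+1]+k*nCk≡n*nCk n       zero    = begin
  1 * (n C 1) + 0 * (n C 0)  ≡⟨ +-identityʳ _ ⟩
  1 * (n C 1)                ≡⟨ *-identityˡ _ ⟩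
  n C 1                      ≡⟨ nC1≡n n ⟩
  n                          ≡⟨ *-identityʳ n ⟨
  n * (n C 0)                ∎
[k+1]*nC[k+1]+k*nCk≡n*nCk zero    (suc k) = cong₂ _+_ (*-zeroʳ (suc (suc k))) (*-zeroʳ (suc k))
[k+1]*nC[k+1]+k*nCk≡n*nCk (suc n) (suc k) = begin
  suc (suc k) * (suc n C suc (suc k)) + suc k * (suc n C suc k)
    ≡⟨ cong₂ (λ x y → suc (suc k) * x + suc k * y) (pascal (suc k)) (pascal k) ⟨
  suc (suc k) * (c₁ + c₂) + suc k * (c₀ + c₁)
    ≡⟨ split k c₀ c₁ c₂ ⟩
  (suc (suc k) * c₂ + suc k * c₁) + (suc k * c₁ + k * c₀) + (c₀ + c₁)
    ≡⟨ cong₂ (λ x y → x + y + (c₀ + c₁)) (ih (suc k)) (ih k) ⟩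
  n * c₁ + n * c₀ + (c₀ + c₁)
    ≡⟨ merge n c₀ c₁ ⟩
  suc n * (c₀ + c₁)
    ≡⟨ cong (suc n *_) (pascal k) ⟩
  suc n * (suc n C suc k)
    ∎
  where
  ih : ∀ k → suc k * (n C suc k) + k * (n C k) ≡ n * (n C k)
  ih = [k+1]*nC[k+1]+k*nCk≡n*nCk n
  pascal : ∀ k → n C k + n C suc k ≡ suc n C suc k
  pascal = nCk+nC[k+1]≡[n+1]C[k+1] n
  c₀ c₁ c₂ : ℕ
  c₀ = n C k
  c₁ = n C suc k
  c₂ = n C suc (suc k)
  split : ∀ k c₀ c₁ c₂ → suc (suc k) * (c₁ + c₂) + suc k * (c₀ + c₁)
                       ≡ (suc (suc k) * c₂ + suc k * c₁) + (suc k * c₁ + k * c₀) + (c₀ + c₁)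
  split = solve-∀
  merge : ∀ n c₀ c₁ → n * c₁ + n * c₀ + (c₀ + c₁) ≡ suc n * (c₀ + c₁)
  merge = solve-∀

[k+1]*[k+a]C[k+1]≡a*[k+a]Ck : ∀ k a → suc k * ((k + a) C suc k) ≡ a * ((k + a) C k)
[k+1]*[k+a]C[k+1]≡a*[k+a]Ck k a = +-cancelʳ-≡ (k * c) _ _ (begin
  suc k * ((k + a) C suc k) + k * c  ≡⟨ [k+1]*nC[k+1]+k*nCk≡n*nCk (k + a) k ⟩
  (k + a) * c                        ≡⟨ *-distribʳ-+ c k a ⟩
  k * c + a * c                      ≡⟨ +-comm (k * c) (a * c) ⟩
  a * c + k * c                      ∎)
  where
  c : ℕ
  c = (k + a) C k

-- Over ℤ the difference of the two sides is 2 (v + u) ((k + a + k) u − a v).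
2k[v+u]²+2[k+a]u²≡2[k+a]v² : ∀ k a u v → (k + a + k) * u ≡ a * v →
  2 * k * (v + u) * (v + u) + 2 * (k + a) * u ^ 2 ≡ 2 * (k + a) * v ^ 2
2k[v+u]²+2[k+a]u²≡2[k+a]v² k a u v [k+a+k]u≡av = +-cancelʳ-≡ (2 * (v + u) * (a * v)) _ _ (begin
  2 * k * (v + u) * (v + u) + 2 * (k + a) * u ^ 2 + 2 * (v + u) * (a * v)
    ≡⟨ expand k a u v ⟩
  2 * (k + a) * v ^ 2 + 2 * (v + u) * ((k + a + k) * u)
    ≡⟨ cong (λ x → 2 * (k + a) * v ^ 2 + 2 * (v + u) * x) [k+a+k]u≡av ⟩
  2 * (k + a) * v ^ 2 + 2 * (v + u) * (a * v)
    ∎)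
  where
  -- The solver does not recognise ℕ's _^_, so x ^ 2 is spelled out as its unfolding x * (x * 1).
  expand : ∀ k a u v → 2 * k * (v + u) * (v + u) + 2 * (k + a) * (u * (u * 1)) + 2 * (v + u) * (a * v)
                     ≡ 2 * (k + a) * (v * (v * 1)) + 2 * (v + u) * ((k + a + k) * u)
  expand = solve-∀

summand : ℕ → ℕ → ℕ
summand m k = 2 * k * ((2 * m) C (m ∸ k)) * ((2 * m) C (m + k))

tail : ℕ → ℕ → ℕ
tail m k = 2 * m * ((2 * m ∸ 1) C (m + k)) ^ 2

summand+tail≡tail : ∀ {m k} → k < m → summand m (suc k) + tail m (suc k) ≡ tail m k
summand+tail≡tail {k = k} k<m with a , refl ← ≤⇒≤″ k<m = begin
  summand m k′ + tail m k′
    ≡⟨ cong₂ (λ x y → 2 * k′ * x * (2 * m C (m + k′)) + 2 * m * y ^ 2)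
             2mC[m∸k′]≡2mC[m+k′] (cong₂ _C_ 2m∸1≡N (+-suc m k)) ⟩
  2 * k′ * (2 * m C (m + k′)) * (2 * m C (m + k′)) + 2 * m * u ^ 2
    ≡⟨ cong (λ x → 2 * k′ * x * x + 2 * m * u ^ 2) 2mC[m+k′]≡v+u ⟩
  2 * k′ * (v + u) * (v + u) + 2 * m * u ^ 2
    ≡⟨ 2k[v+u]²+2[k+a]u²≡2[k+a]v² k′ a u v absorption ⟩
  2 * m * v ^ 2
    ≡⟨ cong (λ x → 2 * m * (x C j) ^ 2) 2m∸1≡N ⟨
  tail m k
    ∎
  where
  k′ m j N u v : ℕ
  k′ = suc k
  m = k′ + a
  j = m + k
  N = j + a
  u = N C suc j
  v = N C j
  2m≡1+N : 2 * m ≡ suc N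
  2m≡1+N = ring-identity k a
    where ring-identity : ∀ k a → 2 * (suc k + a) ≡ suc (suc k + a + k + a)
          ring-identity = solve-∀
  2m∸1≡N : 2 * m ∸ 1 ≡ N
  2m∸1≡N = cong (_∸ 1) 2m≡1+N
  2mC[m∸k′]≡2mC[m+k′] : 2 * m C (m ∸ k′) ≡ 2 * m C (m + k′)
  2mC[m∸k′]≡2mC[m+k′] = begin
    2 * m C (m ∸ k′)            ≡⟨ cong (2 * m C_) (m+n∸m≡n k′ a) ⟩
    2 * m C a                   ≡⟨ cong (_C a) 2m≡a+[m+k′] ⟩
    (a + (m + k′)) C a          ≡⟨ [m+n]Cm≡[m+n]Cn a (m + k′) ⟩
    (a + (m + k′)) C (m + k′)   ≡⟨ cong (_C (m + k′)) 2m≡a+[m+k′] ⟨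
    2 * m C (m + k′)            ∎
    where
    2m≡a+[m+k′] : 2 * m ≡ a + (m + k′)
    2m≡a+[m+k′] = ring-identity k a
      where ring-identity : ∀ k a → 2 * (suc k + a) ≡ a + (suc k + a + suc k)
            ring-identity = solve-∀
  2mC[m+k′]≡v+u : 2 * m C (m + k′) ≡ v + u
  2mC[m+k′]≡v+u = trans (cong₂ _C_ 2m≡1+N (+-suc m k)) (sym (nCk+nC[k+1]≡[n+1]C[k+1] N j))
  absorption : (k′ + a + k′) * u ≡ a * v
  absorption = trans (cong (_* u) (+-suc m k)) ([k+1]*[k+a]C[k+1]≡a*[k+a]Ck j a)

lemma3 : (n : ℕ) → let m = suc n in
    sumFrom1 m (λ k → 2 * k * ((2 * m) C (m ∸ k)) * ((2 * m) C (m + k)))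
      ≡ 2 * m * (((2 * m ∸ 1) C (m ∸ 1)) ^ 2)
lemma3 n = begin
  sumFrom1 m (summand m)             ≡⟨ +-identityʳ _ ⟨
  sumFrom1 m (summand m) + 0         ≡⟨ cong (sumFrom1 m (summand m) +_) tail[m,m]≡0 ⟨
  sumFrom1 m (summand m) + tail m m  ≡⟨ sumFrom1-telescope m (summand m) (tail m) summand+tail≡tail ⟩
  tail m 0                           ≡⟨ cong (λ x → 2 * m * x ^ 2) ([m+n]Cm≡[m+n]Cn n (m + 0)) ⟨
  2 * m * ((2 * m ∸ 1) C n) ^ 2      ∎
  where
  -- Here 2 * m ∸ 1 computes to n + (m + 0).
  m : ℕ
  m = suc n
  tail[m,m]≡0 : tail m m ≡ 0
  tail[m,m]≡0 = trans (cong (λ x → 2 * m * x ^ 2) (k>n⇒nCk≡0 2m∸1<m+m)) (*-zeroʳ (2 * m))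
    where 2m∸1<m+m : 2 * m ∸ 1 < m + m
          2m∸1<m+m = s≤s (≤-reflexive (cong (n +_) (+-identityʳ m)))
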